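{- Let $G=(V,E)$ be a finite undirected graph and let $B_0\subsetneq B_1\subsetneq\cdots\subsetneq B_k$ be all the locally dense subsets of $V$, listed in increasing order. Then $B_0=\emptyset$, $B_k=V$, and for each $1\le i\le k$, $B_i$ is the densest subset properly containing $B_{i-1}$, i.e. $$B_i=\arg\max_{W\supsetneq B_{i-1}} d(W,B_{i-1}).$$
   Context: For $X\subseteq V$, $E(X)=\{(x,y)\in E: x,y\in X\}$. For disjoint $X,Y\subseteq V$, $E(X,Y)=\{(x,y)\in E: x\in X, y\in Y\}$ and $E_m(X,Y)=E(X)\cup E(X,Y)$. For nonempty $X$, $d(X)=|E(X)|/|X|$. For nonempty $X$ disjoint from $Y$, the outer density is $d(X,Y)=|E_m(X,Y)|/|X|$; for general $X,Y$ one sets $d(X,Y)=d(X\setminus Y,Y)$. A set $W\subseteq V$ is locally dense if there do not exist a nonempty $X\subseteq W$ and a nonempty $Y\subseteq V$ with $Y\cap W=\emptyset$ such that $d(X,W\setminus X)\le d(Y,W)$. (The locally dense sets form a chain under inclusion.) -}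

module Defs where

open import Data.Nat using (ℕ; zero; suc; _+_; _<ᵇ_)
open import Data.Bool using (Bool; true; false; _∧_; if_then_else_)
open import Data.Fin using (Fin; toℕ)
open import Data.List using (List; map; allFin)
open import Data.Nat.ListAction using (sum)
open import Data.Vec using (lookup)
open import Data.Fin.Subset using (Subset; _⊆_; _─_; _∩_; ∣_∣; Nonempty; Empty)
open import Data.Integer using (+_)
open import Data.Rational using (ℚ; 0ℚ; _/_; _≤_)
open import Data.Product using (Σ; _×_)
open import Relation.Nullary using (¬_)
open import Relation.Binary.PropositionalEquality using (_≡_)

-- A finite simple undirected graph on vertex set V = Fin n, given by a
-- symmetric irreflexive adjacency relation.  E is the set of unordered
-- edges {x,y} with adj x y ≡ true.
record Graph (n : ℕ) : Set where
  field
    adj   : Fin n → Fin n → Bool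
    sym   : ∀ x y → adj x y ≡ adj y x
    irrfl : ∀ x → adj x x ≡ false
open Graph public

ΣΣ : {n : ℕ} → (Fin n → Fin n → ℕ) → ℕ
ΣΣ {n} f = sum (map (λ x → sum (map (λ y → f x y) (allFin n))) (allFin n))

indicator : Bool → ℕ
indicator b = if b then 1 else 0

module _ {n : ℕ} (G : Graph n) where

  -- |E(X)| : number of (unordered) edges with both endpoints in X
  -- (each edge counted once, via its representative x < y).
  eIn : Subset n → ℕ
  eIn X = ΣΣ (λ x y → indicator (lookup X x ∧ lookup X y ∧ adj G x y ∧ (toℕ x <ᵇ toℕ y)))

  -- |E(X,Y)| : number of edges with one endpoint in X, the other in Y
  -- (for disjoint X, Y each such edge is counted exactly once).
  eBetween : Subset n → Subset n → ℕ
  eBetween X Y = ΣΣ (λ x y → indicator (lookup X x ∧ lookup Y y ∧ adj G x y))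

  -- |E_m(X,Y)| = |E(X) ∪ E(X,Y)| for disjoint X, Y (a disjoint union).
  eM : Subset n → Subset n → ℕ
  eM X Y = eIn X + eBetween X Y

  -- a / b as a rational; value 0 when b = 0 (only used for nonempty sets).
  ratio : ℕ → ℕ → ℚ
  ratio a zero    = 0ℚ
  ratio a (suc b) = (+ a) / suc b

  density : Subset n → ℚ
  density X = ratio (eIn X) ∣ X ∣

  -- outer density for general X, Y: d(X,Y) = d(X ∖ Y, Y) = |E_m(X∖Y,Y)| / |X∖Y|
  outerDensity : Subset n → Subset n → ℚ
  outerDensity X Y = ratio (eM (X ─ Y) Y) ∣ X ─ Y ∣

  LocallyDense : Subset n → Set
  LocallyDense W =
    ¬ (Σ (Subset n) λ X → Σ (Subset n) λ Y →
         X ⊆ W × Nonempty X × Nonempty Y × Empty (Y ∩ W) ×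
         (outerDensity X (W ─ X) ≤ outerDensity Y W))

-- Fix a locally dense A and let M maximise, over all W ⊇ A, first the outer
-- density d(W, A) and then |W ∖ A|.  Write slope W A for the pair
-- (|E_m(W ∖ A, A)|, |W ∖ A|); along A ⊆ C ⊆ W slopes add like mediants, and
-- since |E_m(P, R)| only grows with R, a vertex set contributes more edges to a
-- larger base.  Hence no proper extension of M reaches density d(M, A) over M,
-- while removing any X ⊆ M costs at least d(M, A) per vertex (for X ∩ A this is
-- where local density of A enters); so M is locally dense.  The next set C of the
-- chain is therefore contained in M, and C ⊊ M is impossible because a proper superset of a
-- locally dense C is strictly sparser over A; thus M = C.  Finally, a W ⊋ A as
-- dense as C could be joined to C without lowering the density, against the
-- maximality of |C ∖ A|, so W ⊆ C.

module Submission where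

open import Data.Bool using (true; false; _∧_; _∨_; not; f≤t; b≤b)
import Data.Bool as B
import Data.Bool.Properties as B
open import Data.Bool.Properties using (∧-zeroʳ; ∧-identityʳ)
open import Data.Empty using (⊥-elim)
open import Data.Fin as Fin using (Fin; zero; suc; toℕ; inject₁; fromℕ)
open import Data.Fin.Induction using (<-weakInduction-startingFrom)
open import Data.Fin.Properties using (toℕ-injective; toℕ-inject₁; ≤fromℕ)
open import Data.Fin.Subset
  using (Subset; ⊥; ⊤; ∣_∣; _─_; _∪_; _∩_; _⊆_; _⊂_; _∈_; _∉_; Empty; Nonempty)
open import Data.Fin.Subset.Properties
  using (_∈?_; nonempty?; Empty-unique; ∣⊥∣≡0; ⊥⊆; ∉⊥; ⊆⊤; ∈⊤; ⊆-refl; ⊆-trans; ⊆-antisym;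
         p⊂q⇒∣p∣<∣q∣; p⊆p∪q; q⊆p∪q; x∈p∪q⁻; x∈p∩q⁺; x∈p∩q⁻; p─q⊆p; p─q─q≡p─q;
         x∈p∧x∉q⇒x∈p─q)
import Data.Integer as ℤ
import Data.Integer.Properties as ℤ
open import Data.List using (tabulate; map; allFin)
open import Data.List.Properties using (map-tabulate)
import Data.Nat.ListAction as List
open import Data.Nat as ℕ using (ℕ; zero; suc; _+_; _*_; _<ᵇ_; z≤n)
import Data.Nat.Properties as ℕ
open import Data.Nat.Tactic.RingSolver using (solve-∀)
open import Algebra.Properties.Semiring.Sum ℕ.+-*-semiring
  using (sum; sum-syntax; ∑-distrib-+; ∑-comm; sum-cong-≗; sum-replicate-zero)
open import Data.Product using (Σ; _×_; _,_; proj₁; proj₂)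
open import Data.Product.Relation.Binary.Lex.NonStrict using (×-Lex; ×-transitive; ×-total)
open import Data.Rational as ℚ using (ℚ; 0ℚ; _≤_)
import Data.Rational.Properties as ℚ
open import Data.Rational.Unnormalised using (mkℚᵘ; *≤*)
import Data.Rational.Unnormalised.Properties as ℚᵘ
open import Data.Sum using (inj₁; inj₂; [_,_]′)
open import Data.Vec using ([]; _∷_; lookup; here; there)
import Data.Vec.Properties as Vec
open import Function using (_∘_; id; case_of_)
open import Function.Bundles using (_⇔_; Equivalence)
open import Relation.Binary using (Rel; Reflexive; Transitive; Total; Antisymmetric)
open import Relation.Binary.PropositionalEquality
open import Relation.Nullary using (¬_; yes; no; ofʸ; ofⁿ; contradiction)

open import Defs hiding (sym)

Frac : Set
Frac = ℕ × ℕ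

infix 4 _⊴_
infixl 6 _⊞_

_⊴_ : Frac → Frac → Set
(a , b) ⊴ (c , d) = a * d ℕ.≤ c * b

_⊞_ : Frac → Frac → Frac
(a , b) ⊞ (c , d) = a + c , b + d

⊴-refl : ∀ x → x ⊴ x
⊴-refl _ = ℕ.≤-refl

⊴-zero-denominator : ∀ ρ a → ρ ⊴ (a , 0)
⊴-zero-denominator (ν , δ) a rewrite ℕ.*-zeroʳ ν = z≤n

⊴-mono-numerator : ∀ ρ {a a'} b → a ℕ.≤ a' → ρ ⊴ (a , b) → ρ ⊴ (a' , b)
⊴-mono-numerator (ν , δ) b a≤a' ρ⊴ = ℕ.≤-trans ρ⊴ (ℕ.*-monoˡ-≤ δ a≤a')

⊴-⊞ : ∀ ρ x y → ρ ⊴ x → ρ ⊴ y → ρ ⊴ x ⊞ y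
⊴-⊞ (ν , δ) (a , b) (c , d) ρ⊴x ρ⊴y = begin
  ν * (b + d)     ≡⟨ ℕ.*-distribˡ-+ ν b d ⟩
  ν * b + ν * d   ≤⟨ ℕ.+-mono-≤ ρ⊴x ρ⊴y ⟩
  a * δ + c * δ   ≡⟨ ℕ.*-distribʳ-+ δ a c ⟨
  (a + c) * δ     ∎
  where open ℕ.≤-Reasoning

⊴-⊞-cancel : ∀ ρ x y → ρ ⊴ y ⊞ x → y ⊴ ρ → ρ ⊴ x
⊴-⊞-cancel (ν , δ) (a , b) (c , d) ρ⊴y+x y⊴ρ = ℕ.+-cancelʳ-≤ (ν * d) (ν * b) (a * δ) (begin
  ν * b + ν * d   ≡⟨ ℕ.+-comm (ν * b) (ν * d) ⟩
  ν * d + ν * b   ≡⟨ ℕ.*-distribˡ-+ ν d b ⟨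
  ν * (d + b)     ≤⟨ ρ⊴y+x ⟩
  (c + a) * δ     ≡⟨ ℕ.*-distribʳ-+ δ c a ⟩
  c * δ + a * δ   ≤⟨ ℕ.+-monoˡ-≤ (a * δ) y⊴ρ ⟩
  ν * d + a * δ   ≡⟨ ℕ.+-comm (ν * d) (a * δ) ⟩
  a * δ + ν * d   ∎)
  where open ℕ.≤-Reasoning

/-≤⇒⊴ : ∀ a b c d → (ℤ.+ a) ℚ./ suc b ℚ.≤ (ℤ.+ c) ℚ./ suc d → (a , suc b) ⊴ (c , suc d)
/-≤⇒⊴ a b c d h = ℤ.drop‿+≤+
  (subst₂ ℤ._≤_ (sym (ℤ.pos-* a (suc d))) (sym (ℤ.pos-* c (suc b)))
    (ℚᵘ.drop-*≤* (ℚᵘ.≤-respʳ-≃ (ℚ.toℚᵘ-fromℚᵘ (mkℚᵘ (ℤ.+ c) d))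
                   (ℚᵘ.≤-respˡ-≃ (ℚ.toℚᵘ-fromℚᵘ (mkℚᵘ (ℤ.+ a) b)) (ℚ.toℚᵘ-mono-≤ h)))))

⊴⇒/-≤ : ∀ a b c d → (a , suc b) ⊴ (c , suc d) → (ℤ.+ a) ℚ./ suc b ℚ.≤ (ℤ.+ c) ℚ./ suc d
⊴⇒/-≤ a b c d h = ℚ.toℚᵘ-cancel-≤
  (ℚᵘ.≤-respʳ-≃ (ℚᵘ.≃-sym (ℚ.toℚᵘ-fromℚᵘ (mkℚᵘ (ℤ.+ c) d)))
    (ℚᵘ.≤-respˡ-≃ (ℚᵘ.≃-sym (ℚ.toℚᵘ-fromℚᵘ (mkℚᵘ (ℤ.+ a) b)))
      (*≤* (subst₂ ℤ._≤_ (ℤ.pos-* a (suc d)) (ℤ.pos-* c (suc b)) (ℤ.+≤+ h)))))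

sum-tabulate : ∀ {m} (f : Fin m → ℕ) → List.sum (tabulate f) ≡ sum f
sum-tabulate {zero}  f = refl
sum-tabulate {suc m} f = cong (f zero +_) (sum-tabulate (f ∘ suc))

ΣΣ≡∑∑ : ∀ {n} (f : Fin n → Fin n → ℕ) → ΣΣ f ≡ ∑[ x < n ] ∑[ y < n ] f x y
ΣΣ≡∑∑ {n} f = trans (listSum f') (sum-cong-≗ λ x → listSum (f x))
  where
  f' : Fin n → ℕ
  f' x = List.sum (map (f x) (allFin n))
  listSum : (g : Fin n → ℕ) → List.sum (map g (allFin n)) ≡ sum g
  listSum g = trans (cong List.sum (map-tabulate id g)) (sum-tabulate g)

indicator-∧ : ∀ p q → indicator (p ∧ q) ≡ indicator p * indicator q
indicator-∧ false q     = refl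
indicator-∧ true  false = refl
indicator-∧ true  true  = refl

<ᵇ-exactly-one : ∀ m n → m ≢ n → indicator (m <ᵇ n) + indicator (n <ᵇ m) ≡ 1
<ᵇ-exactly-one m n m≢n
  with m <ᵇ n | ℕ.<ᵇ-reflects-< m n | n <ᵇ m | ℕ.<ᵇ-reflects-< n m
... | true  | ofʸ m<n | true  | ofʸ n<m = contradiction n<m (ℕ.<-asym m<n)
... | true  | _       | false | _       = refl
... | false | _       | true  | _       = refl
... | false | ofⁿ m≮n | false | ofⁿ n≮m =
  contradiction (ℕ.≤-antisym (ℕ.≮⇒≥ n≮m) (ℕ.≮⇒≥ m≮n)) m≢n

module SymmetricKernel {n : ℕ} (a : Fin n → Fin n → ℕ) (a-sym : ∀ x y → a x y ≡ a y x) where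

  Weight : Set
  Weight = Fin n → ℕ

  infixl 6 _⊕_

  _⊕_ : Weight → Weight → Weight
  (u ⊕ v) x = u x + v x

  Q : Weight → Weight → ℕ
  Q u v = ∑[ x < n ] ∑[ y < n ] (u x * (v y * a x y))

  Q-cong : ∀ {u u' v v'} → u ≗ u' → v ≗ v' → Q u v ≡ Q u' v'
  Q-cong u≗u' v≗v' = sum-cong-≗ λ x → sum-cong-≗ λ y →
    cong₂ (λ p q → p * (q * a x y)) (u≗u' x) (v≗v' y)

  Q-linearˡ : ∀ u u' v → Q (u ⊕ u') v ≡ Q u v + Q u' v
  Q-linearˡ u u' v = trans
    (sum-cong-≗ λ x → trans
      (sum-cong-≗ λ y → ℕ.*-distribʳ-+ (v y * a x y) (u x) (u' x))
      (∑-distrib-+ (λ y → u x * (v y * a x y)) (λ y → u' x * (v y * a x y))))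
    (∑-distrib-+ (λ x → ∑[ y < n ] (u x * (v y * a x y)))
                 (λ x → ∑[ y < n ] (u' x * (v y * a x y))))

  Q-sym : ∀ u v → Q u v ≡ Q v u
  Q-sym u v = trans (∑-comm (λ x y → u x * (v y * a x y)))
    (sum-cong-≗ λ y → sum-cong-≗ λ x → trans
      (cong (λ b → u x * (v y * b)) (a-sym x y))
      (swap (u x) (v y) (a y x)))
    where
    swap : ∀ p q r → p * (q * r) ≡ q * (p * r)
    swap = solve-∀

  Q-linearʳ : ∀ u v v' → Q u (v ⊕ v') ≡ Q u v + Q u v'
  Q-linearʳ u v v' = trans (Q-sym u (v ⊕ v'))
    (trans (Q-linearˡ v v' u) (cong₂ _+_ (Q-sym v u) (Q-sym v' u)))

  Q-zeroˡ : ∀ {u} v → u ≗ (λ _ → 0) → Q u v ≡ 0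
  Q-zeroˡ v u≗0 = trans
    (sum-cong-≗ λ x → trans (sum-cong-≗ λ y → cong (λ p → p * (v y * a x y)) (u≗0 x))
                            (sum-replicate-zero n))
    (sum-replicate-zero n)

  twiceEₘ : Weight → Weight → ℕ
  twiceEₘ u v = Q u u + 2 * Q u v

  twiceEₘ-cong : ∀ {u u' v v'} → u ≗ u' → v ≗ v' → twiceEₘ u v ≡ twiceEₘ u' v'
  twiceEₘ-cong u≗u' v≗v' = cong₂ _+_ (Q-cong u≗u' u≗u') (cong (2 *_) (Q-cong u≗u' v≗v'))

  twiceEₘ-split : ∀ p q r → twiceEₘ (p ⊕ q) r ≡ twiceEₘ p r + twiceEₘ q (r ⊕ p)
  twiceEₘ-split p q r
    rewrite Q-linearˡ p q (p ⊕ q) | Q-linearʳ p p q | Q-linearʳ q p q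
          | Q-linearˡ p q r | Q-linearʳ q r p | Q-sym q p
    = regroup (Q p p) (Q p q) (Q q q) (Q p r) (Q q r)
    where
    regroup : ∀ pp pq qq pr qr →
      pp + pq + (pq + qq) + 2 * (pr + qr) ≡ pp + 2 * pr + (qq + 2 * (qr + pq))
    regroup = solve-∀

  twiceEₘ-monoʳ : ∀ s r t → twiceEₘ s r ℕ.≤ twiceEₘ s (r ⊕ t)
  twiceEₘ-monoʳ s r t rewrite Q-linearʳ s r t | ℕ.*-distribˡ-+ 2 (Q s r) (Q s t)
                          | sym (ℕ.+-assoc (Q s s) (2 * Q s r) (2 * Q s t))
    = ℕ.m≤m+n (twiceEₘ s r) (2 * Q s t)

  twiceEₘ-zeroˡ : ∀ {u} v → u ≗ (λ _ → 0) → twiceEₘ u v ≡ 0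
  twiceEₘ-zeroˡ {u} v u≗0 = cong₂ _+_ (Q-zeroˡ u u≗0) (cong (2 *_) (Q-zeroˡ v u≗0))

lookup-─ : ∀ {m} (p q : Subset m) x → lookup (p ─ q) x ≡ lookup p x ∧ not (lookup q x)
lookup-─ (b ∷ p) (true  ∷ q) zero    = sym (∧-zeroʳ b)
lookup-─ (b ∷ p) (false ∷ q) zero    = sym (∧-identityʳ b)
lookup-─ (_ ∷ p) (_     ∷ q) (suc x) = lookup-─ p q x

lookup-∪ : ∀ {m} (p q : Subset m) x → lookup (p ∪ q) x ≡ lookup p x ∨ lookup q x
lookup-∪ p q x = Vec.lookup-zipWith _∨_ x p q

⊆⇒lookup-≤ : ∀ {m} {p q : Subset m} → p ⊆ q → ∀ x → lookup p x B.≤ lookup q x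
⊆⇒lookup-≤ {p = p} {q} p⊆q x with lookup p x in px
... | false = B.≤-minimum (lookup q x)
... | true  = B.≤-reflexive (sym (Vec.[]=⇒lookup (p⊆q (Vec.lookup⇒[]= x p px))))

lookup-ext : ∀ {m} {p q : Subset m} → (∀ x → lookup p x ≡ lookup q x) → p ≡ q
lookup-ext {p = p} {q} p≗q =
  trans (sym (Vec.tabulate∘lookup p)) (trans (Vec.tabulate-cong p≗q) (Vec.tabulate∘lookup q))

x∈p─q⇒x∉q : ∀ {m} {x : Fin m} (p q : Subset m) → x ∈ p ─ q → x ∉ q
x∈p─q⇒x∉q (_ ∷ p) (false ∷ q) here        ()
x∈p─q⇒x∉q (_ ∷ p) (_     ∷ q) (there x∈) (there x∈q) = x∈p─q⇒x∉q p q x∈ x∈q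

p─[p─q]⊆q : ∀ {m} (p q : Subset m) → p ─ (p ─ q) ⊆ q
p─[p─q]⊆q p q {x} x∈ with x ∈? q
... | yes x∈q = x∈q
... | no  x∉q =
  contradiction (x∈p∧x∉q⇒x∈p─q (p─q⊆p p (p ─ q) x∈) x∉q) (x∈p─q⇒x∉q p (p ─ q) x∈)

[p─q]∩q-empty : ∀ {m} (p q : Subset m) → Empty ((p ─ q) ∩ q)
[p─q]∩q-empty p q (x , x∈) with x∈p∩q⁻ (p ─ q) q x∈
... | x∈p─q , x∈q = x∈p─q⇒x∉q p q x∈p─q x∈q

⊂⇒nonempty-─ : ∀ {m} {A W : Subset m} → A ⊂ W → Nonempty (W ─ A)
⊂⇒nonempty-─ (_ , x , x∈W , x∉A) = x , x∈p∧x∉q⇒x∈p─q x∈W x∉A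

nonempty-─⇒⊂ : ∀ {m} {A W : Subset m} → A ⊆ W → Nonempty (W ─ A) → A ⊂ W
nonempty-─⇒⊂ {A = A} {W} A⊆W (x , x∈) = A⊆W , x , p─q⊆p W A x∈ , x∈p─q⇒x∉q W A x∈

nonempty⇒∣p∣>0 : ∀ {m} {p : Subset m} → Nonempty p → 0 ℕ.< ∣ p ∣
nonempty⇒∣p∣>0 {m} {p} (x , x∈p) =
  subst (ℕ._< ∣ p ∣) (∣⊥∣≡0 m) (p⊂q⇒∣p∣<∣q∣ (⊥⊆ , x , x∈p , ∉⊥))

empty⇒∣p∣≡0 : ∀ {m} {p : Subset m} → Empty p → ∣ p ∣ ≡ 0
empty⇒∣p∣≡0 {m} p-empty = trans (cong ∣_∣ (Empty-unique p-empty)) (∣⊥∣≡0 m)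

∣p∣≡sum : ∀ {m} (X : Subset m) → ∣ X ∣ ≡ sum (λ x → indicator (lookup X x))
∣p∣≡sum []          = refl
∣p∣≡sum (true ∷ X)  = cong suc (∣p∣≡sum X)
∣p∣≡sum (false ∷ X) = ∣p∣≡sum X

infix 4 _≐_⊔_

_≐_⊔_ : ∀ {m} → Subset m → Subset m → Subset m → Set
S ≐ P ⊔ Q = ∀ x → indicator (lookup S x) ≡ indicator (lookup P x) + indicator (lookup Q x)

⊆-partition : ∀ {m} {R R' : Subset m} → R ⊆ R' → R' ≐ R ⊔ (R' ─ R)
⊆-partition {R = R} {R'} R⊆R' x rewrite lookup-─ R' R x = pointwise (⊆⇒lookup-≤ R⊆R' x)
  where
  pointwise : ∀ {r r'} → r B.≤ r' → indicator r' ≡ indicator r + indicator (r' ∧ not r)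
  pointwise f≤t         = refl
  pointwise {false} b≤b = refl
  pointwise {true}  b≤b = refl

tower-partition : ∀ {m} {A C W : Subset m} → A ⊆ C → C ⊆ W → W ─ A ≐ (C ─ A) ⊔ (W ─ C)
tower-partition {A = A} {C} {W} A⊆C C⊆W x
  rewrite lookup-─ W A x | lookup-─ C A x | lookup-─ W C x
  = pointwise (⊆⇒lookup-≤ A⊆C x) (⊆⇒lookup-≤ C⊆W x)
  where
  pointwise : ∀ {a c w} → a B.≤ c → c B.≤ w →
    indicator (w ∧ not a) ≡ indicator (c ∧ not a) + indicator (w ∧ not c)
  pointwise f≤t         b≤b = refl
  pointwise b≤b         f≤t = refl
  pointwise {false} b≤b b≤b = refl
  pointwise {true}  b≤b b≤b = refl

p─[p─q]≡q : ∀ {m} {A C : Subset m} → A ⊆ C → C ─ (C ─ A) ≡ A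
p─[p─q]≡q {A = A} {C} A⊆C = lookup-ext λ x →
  trans (lookup-─ C (C ─ A) x) (trans (cong (λ b → lookup C x ∧ not b) (lookup-─ C A x))
        (pointwise (⊆⇒lookup-≤ A⊆C x)))
  where
  pointwise : ∀ {a c} → a B.≤ c → c ∧ not (c ∧ not a) ≡ a
  pointwise f≤t         = refl
  pointwise {false} b≤b = refl
  pointwise {true}  b≤b = refl

p─[q─p]≡p : ∀ {m} (X W : Subset m) → X ─ (W ─ X) ≡ X
p─[q─p]≡p X W = lookup-ext λ x →
  trans (lookup-─ X (W ─ X) x) (trans (cong (λ b → lookup X x ∧ not b) (lookup-─ W X x))
        (pointwise (lookup X x) (lookup W x)))
  where
  pointwise : ∀ a w → a ∧ not (w ∧ not a) ≡ a
  pointwise false w     = refl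
  pointwise true  false = refl
  pointwise true  true  = refl

[p∪q]─p≡q─p : ∀ {m} (W Y : Subset m) → (W ∪ Y) ─ W ≡ Y ─ W
[p∪q]─p≡q─p W Y = lookup-ext λ x →
  trans (lookup-─ (W ∪ Y) W x) (trans (cong (λ b → b ∧ not (lookup W x)) (lookup-∪ W Y x))
        (trans (pointwise (lookup W x) (lookup Y x)) (sym (lookup-─ Y W x))))
  where
  pointwise : ∀ w y → (w ∨ y) ∧ not w ≡ y ∧ not w
  pointwise false y = refl
  pointwise true  y = sym (∧-zeroʳ y)

q⊆p⇒p∪q≡p : ∀ {m} {A W : Subset m} → A ⊆ W → W ∪ A ≡ W
q⊆p⇒p∪q≡p {A = A} {W} A⊆W = lookup-ext λ x →
  trans (lookup-∪ W A x) (pointwise (⊆⇒lookup-≤ A⊆W x))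
  where
  pointwise : ∀ {a w} → a B.≤ w → w ∨ a ≡ w
  pointwise f≤t         = refl
  pointwise {false} b≤b = refl
  pointwise {true}  b≤b = refl

argmax : ∀ {k ℓ} {K : Set k} {_≲_ : Rel K ℓ} → Transitive _≲_ → Total _≲_ →
         ∀ m (f : Subset m → K) → Σ (Subset m) λ M → ∀ W → f W ≲ f M
argmax ≲-trans ≲-total zero f = [] , λ { [] → [ id , id ]′ (≲-total (f []) (f [])) }
argmax ≲-trans ≲-total (suc m) f
  with argmax ≲-trans ≲-total m (f ∘ (true ∷_)) | argmax ≲-trans ≲-total m (f ∘ (false ∷_))
... | M₁ , max₁ | M₀ , max₀ with ≲-total (f (true ∷ M₁)) (f (false ∷ M₀))
...   | inj₁ f₁≲f₀ =
  false ∷ M₀ , λ { (true ∷ W) → ≲-trans (max₁ W) f₁≲f₀ ; (false ∷ W) → max₀ W }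
...   | inj₂ f₀≲f₁ =
  true ∷ M₁ , λ { (true ∷ W) → max₁ W ; (false ∷ W) → ≲-trans (max₀ W) f₀≲f₁ }

module ×-LexProperties {a b ℓ₁ ℓ₂} {A : Set a} {B : Set b}
  (_≤₁_ : Rel A ℓ₁) (_≤₂_ : Rel B ℓ₂) where

  ×-Lex⇒≤₁ : Reflexive _≤₁_ → ∀ {p q c d} → ×-Lex _≡_ _≤₁_ _≤₂_ (p , c) (q , d) → p ≤₁ q
  ×-Lex⇒≤₁ _       (inj₁ (p≤q , _))  = p≤q
  ×-Lex⇒≤₁ ≤₁-refl (inj₂ (refl , _)) = ≤₁-refl

  ×-Lex⇒≤₂ : Antisymmetric _≡_ _≤₁_ → ∀ {p q c d} →
    ×-Lex _≡_ _≤₁_ _≤₂_ (p , c) (q , d) → q ≤₁ p → c ≤₂ d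
  ×-Lex⇒≤₂ antisym (inj₁ (p≤q , p≢q)) q≤p = contradiction (antisym p≤q q≤p) p≢q
  ×-Lex⇒≤₂ _       (inj₂ (_ , c≤d))   _   = c≤d

module EdgeCounts {n : ℕ} (G : Graph n) where

  adjacency : Fin n → Fin n → ℕ
  adjacency x y = indicator (adj G x y)

  open SymmetricKernel adjacency (λ x y → cong indicator (Graph.sym G x y)) public

  ⟦_⟧ : Subset n → Weight
  ⟦ X ⟧ x = indicator (lookup X x)

  eBetween≡Q : ∀ X Y → eBetween G X Y ≡ Q ⟦ X ⟧ ⟦ Y ⟧
  eBetween≡Q X Y = trans (ΣΣ≡∑∑ λ x y → indicator (lookup X x ∧ lookup Y y ∧ adj G x y))
    (sum-cong-≗ λ x → sum-cong-≗ λ y →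
      trans (indicator-∧ (lookup X x) _) (cong (⟦ X ⟧ x *_) (indicator-∧ (lookup Y y) _)))

  edge-counted-once : ∀ x y →
    indicator (adj G x y ∧ (toℕ x <ᵇ toℕ y)) + indicator (adj G y x ∧ (toℕ y <ᵇ toℕ x)) ≡ adjacency x y
  edge-counted-once x y rewrite Graph.sym G y x with adj G x y in xy
  ... | false = refl
  ... | true  = <ᵇ-exactly-one (toℕ x) (toℕ y) λ x≡y →
    contradiction (trans (cong (adj G x) (toℕ-injective x≡y)) xy)
                  (λ xx≡true → case trans (sym (Graph.irrfl G x)) xx≡true of λ ())

  twice-eIn≡Q : ∀ X → 2 * eIn G X ≡ Q ⟦ X ⟧ ⟦ X ⟧
  twice-eIn≡Q X = begin
    2 * eIn G X                              ≡⟨ cong (2 *_) (ΣΣ≡∑∑ g) ⟩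
    2 * ∑∑g                                  ≡⟨ cong (∑∑g +_) (ℕ.+-identityʳ ∑∑g) ⟩
    ∑∑g + ∑∑g                                ≡⟨ cong (∑∑g +_) (∑-comm g) ⟩
    ∑∑g + ∑[ x < n ] ∑[ y < n ] g y x
      ≡⟨ ∑-distrib-+ (λ x → sum (g x)) (λ x → ∑[ y < n ] g y x) ⟨
    ∑[ x < n ] (sum (g x) + ∑[ y < n ] g y x)
      ≡⟨ sum-cong-≗ (λ x → ∑-distrib-+ (g x) (λ y → g y x)) ⟨
    ∑[ x < n ] ∑[ y < n ] (g x y + g y x)    ≡⟨ sum-cong-≗ (λ x → sum-cong-≗ (pair x)) ⟩
    Q ⟦ X ⟧ ⟦ X ⟧                            ∎
    where
    open ≡-Reasoning
    g : Fin n → Fin n → ℕ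
    g x y = indicator (lookup X x ∧ lookup X y ∧ adj G x y ∧ (toℕ x <ᵇ toℕ y))
    ∑∑g : ℕ
    ∑∑g = ∑[ x < n ] ∑[ y < n ] g x y
    pair : ∀ x y → g x y + g y x ≡ ⟦ X ⟧ x * (⟦ X ⟧ y * adjacency x y)
    pair x y with lookup X x | lookup X y
    ... | false | false = refl
    ... | false | true  = refl
    ... | true  | false = refl
    ... | true  | true  = trans (edge-counted-once x y)
                                (sym (trans (ℕ.*-identityˡ _) (ℕ.*-identityˡ _)))

  twice-eM≡twiceEₘ : ∀ X Y → 2 * eM G X Y ≡ twiceEₘ ⟦ X ⟧ ⟦ Y ⟧
  twice-eM≡twiceEₘ X Y = trans (ℕ.*-distribˡ-+ 2 (eIn G X) (eBetween G X Y))
    (cong₂ _+_ (twice-eIn≡Q X) (cong (2 *_) (eBetween≡Q X Y)))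

  eM-split : ∀ {S P Q R R'} → S ≐ P ⊔ Q → R' ≐ R ⊔ P → eM G S R ≡ eM G P R + eM G Q R'
  eM-split {S} {P} {Q} {R} {R'} S≐P⊔Q R'≐R⊔P = ℕ.*-cancelˡ-≡ _ _ 2 (begin
    2 * eM G S R                                    ≡⟨ twice-eM≡twiceEₘ S R ⟩
    twiceEₘ ⟦ S ⟧ ⟦ R ⟧
      ≡⟨ twiceEₘ-cong {v = ⟦ R ⟧} S≐P⊔Q (λ _ → refl) ⟩
    twiceEₘ (⟦ P ⟧ ⊕ ⟦ Q ⟧) ⟦ R ⟧
      ≡⟨ twiceEₘ-split ⟦ P ⟧ ⟦ Q ⟧ ⟦ R ⟧ ⟩
    twiceEₘ ⟦ P ⟧ ⟦ R ⟧ + twiceEₘ ⟦ Q ⟧ (⟦ R ⟧ ⊕ ⟦ P ⟧)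
      ≡⟨ cong (twiceEₘ ⟦ P ⟧ ⟦ R ⟧ +_) (twiceEₘ-cong {u = ⟦ Q ⟧} (λ _ → refl) R'≐R⊔P) ⟨
    twiceEₘ ⟦ P ⟧ ⟦ R ⟧ + twiceEₘ ⟦ Q ⟧ ⟦ R' ⟧
      ≡⟨ cong₂ _+_ (twice-eM≡twiceEₘ P R) (twice-eM≡twiceEₘ Q R') ⟨
    2 * eM G P R + 2 * eM G Q R'
      ≡⟨ ℕ.*-distribˡ-+ 2 (eM G P R) (eM G Q R') ⟨
    2 * (eM G P R + eM G Q R') ∎)
    where open ≡-Reasoning

  eM-monoʳ : ∀ S {R R'} → R ⊆ R' → eM G S R ℕ.≤ eM G S R'
  eM-monoʳ S {R} {R'} R⊆R' = ℕ.*-cancelˡ-≤ 2 (begin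
    2 * eM G S R                          ≡⟨ twice-eM≡twiceEₘ S R ⟩
    twiceEₘ ⟦ S ⟧ ⟦ R ⟧                     ≤⟨ twiceEₘ-monoʳ ⟦ S ⟧ ⟦ R ⟧ ⟦ R' ─ R ⟧ ⟩
    twiceEₘ ⟦ S ⟧ (⟦ R ⟧ ⊕ ⟦ R' ─ R ⟧)
      ≡⟨ twiceEₘ-cong {u = ⟦ S ⟧} (λ _ → refl) (⊆-partition R⊆R') ⟨
    twiceEₘ ⟦ S ⟧ ⟦ R' ⟧                    ≡⟨ twice-eM≡twiceEₘ S R' ⟨
    2 * eM G S R'                         ∎)
    where open ℕ.≤-Reasoning

  eM-empty : ∀ {S} R → Empty S → eM G S R ≡ 0
  eM-empty {S} R S-empty = ℕ.*-cancelˡ-≡ _ 0 2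
    (trans (twice-eM≡twiceEₘ S R) (twiceEₘ-zeroˡ ⟦ R ⟧ λ x →
      trans (cong (λ T → indicator (lookup T x)) (Empty-unique S-empty))
            (cong indicator (Vec.lookup-replicate x false))))

  ∣∣-split : ∀ {S P Q} → S ≐ P ⊔ Q → ∣ S ∣ ≡ ∣ P ∣ + ∣ Q ∣
  ∣∣-split {S} {P} {Q} S≐P⊔Q = begin
    ∣ S ∣                ≡⟨ ∣p∣≡sum S ⟩
    sum ⟦ S ⟧            ≡⟨ sum-cong-≗ S≐P⊔Q ⟩
    sum (⟦ P ⟧ ⊕ ⟦ Q ⟧)  ≡⟨ ∑-distrib-+ ⟦ P ⟧ ⟦ Q ⟧ ⟩
    sum ⟦ P ⟧ + sum ⟦ Q ⟧ ≡⟨ cong₂ _+_ (∣p∣≡sum P) (∣p∣≡sum Q) ⟨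
    ∣ P ∣ + ∣ Q ∣        ∎
    where open ≡-Reasoning

module Densities {n : ℕ} (G : Graph n) where

  open EdgeCounts G
  open ×-LexProperties ℚ._≤_ ℕ._≤_

  slope : Subset n → Subset n → Frac
  slope W A = eM G (W ─ A) A , ∣ W ─ A ∣

  value : Frac → ℚ
  value (a , b) = ratio G a b

  slope-tower : ∀ {A C W} → A ⊆ C → C ⊆ W → slope W A ≡ slope C A ⊞ slope W C
  slope-tower {A} {C} {W} A⊆C C⊆W = cong₂ _,_
    (eM-split {W ─ A} {C ─ A} {W ─ C} {A} {C} W─A-split (⊆-partition A⊆C))
    (∣∣-split {W ─ A} {C ─ A} {W ─ C} W─A-split)
    where
    W─A-split : W ─ A ≐ (C ─ A) ⊔ (W ─ C)
    W─A-split = tower-partition A⊆C C⊆W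

  outerDensity-cong : ∀ {X X' Y} → X ─ Y ≡ X' ─ Y → outerDensity G X Y ≡ outerDensity G X' Y
  outerDensity-cong {Y = Y} = cong λ Z → ratio G (eM G Z Y) ∣ Z ∣

  outerDensity-─ : ∀ X Y → outerDensity G (X ─ Y) Y ≡ outerDensity G X Y
  outerDensity-─ X Y = outerDensity-cong (p─q─q≡p─q X Y)

  ⊴⇒≤ : ∀ {x y} → 0 ℕ.< proj₂ x → 0 ℕ.< proj₂ y → x ⊴ y → value x ℚ.≤ value y
  ⊴⇒≤ {a , suc b} {c , suc d} _ _ = ⊴⇒/-≤ a b c d

  ≤⇒⊴ : ∀ {x y} → 0 ℕ.< proj₂ x → 0 ℕ.< proj₂ y → value x ℚ.≤ value y → x ⊴ y
  ≤⇒⊴ {a , suc b} {c , suc d} _ _ = /-≤⇒⊴ a b c d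

  value-nonneg : ∀ x → 0ℚ ℚ.≤ value x
  value-nonneg (a , zero)  = ℚ.≤-refl
  value-nonneg (a , suc b) = ⊴⇒/-≤ 0 0 a b z≤n

  locallyDense⇒< : ∀ {W X Y} → LocallyDense G W → X ⊆ W → Nonempty X → Nonempty Y →
    Empty (Y ∩ W) → outerDensity G Y W ℚ.< outerDensity G X (W ─ X)
  locallyDense⇒< W-dense X⊆W X≠∅ Y≠∅ Y∩W=∅ = ℚ.≰⇒> λ ≤ →
    W-dense (_ , _ , X⊆W , X≠∅ , Y≠∅ , Y∩W=∅ , ≤)

  ⊥-locallyDense : LocallyDense G ⊥
  ⊥-locallyDense (_ , _ , X⊆⊥ , (x , x∈X) , _) = ∉⊥ (X⊆⊥ x∈X)

  ⊤-locallyDense : LocallyDense G ⊤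
  ⊤-locallyDense (_ , _ , _ , _ , (y , y∈Y) , Y∩⊤=∅ , _) = Y∩⊤=∅ (y , x∈p∩q⁺ (y∈Y , ∈⊤))

  key : Subset n → Subset n → ℚ × ℕ
  key A W = outerDensity G W A , ∣ W ─ A ∣

  _≤ₗₑₓ_ : ℚ × ℕ → ℚ × ℕ → Set
  _≤ₗₑₓ_ = ×-Lex _≡_ ℚ._≤_ ℕ._≤_

  DensestAbove : Subset n → Subset n → Set
  DensestAbove A M = A ⊆ M × ∀ W → A ⊆ W → key A W ≤ₗₑₓ key A M

  ≤ₗₑₓ-trans : Transitive _≤ₗₑₓ_
  ≤ₗₑₓ-trans = ×-transitive {_≤₂_ = ℕ._≤_} ℚ.≤-isPartialOrder ℕ.≤-trans

  ≤ₗₑₓ-total : Total _≤ₗₑₓ_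
  ≤ₗₑₓ-total = ×-total sym ℚ._≟_ ℚ.≤-antisym ℚ.≤-total ℕ.≤-total

  densestAbove-exists : ∀ A → Σ (Subset n) (DensestAbove A)
  densestAbove-exists A with argmax ≤ₗₑₓ-trans ≤ₗₑₓ-total n (key A ∘ (_∪ A))
  ... | M , max = M ∪ A , q⊆p∪q M A , λ W A⊆W →
    subst (λ Z → key A Z ≤ₗₑₓ key A (M ∪ A)) (q⊆p⇒p∪q≡p A⊆W) (max W)

  module _ {A M : Subset n} (M-densest : DensestAbove A M) where

    densest-≤ : ∀ {W} → A ⊆ W → outerDensity G W A ℚ.≤ outerDensity G M A
    densest-≤ A⊆W = ×-Lex⇒≤₁ ℚ.≤-refl (proj₂ M-densest _ A⊆W)

    densest-size : ∀ {W} → A ⊆ W → outerDensity G M A ℚ.≤ outerDensity G W A →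
      ∣ W ─ A ∣ ℕ.≤ ∣ M ─ A ∣
    densest-size A⊆W = ×-Lex⇒≤₂ ℚ.≤-antisym (proj₂ M-densest _ A⊆W)

    densest-⊴ : ∀ {W} → A ⊆ W → slope W A ⊴ slope M A
    densest-⊴ {W} A⊆W with nonempty? (W ─ A) | nonempty? (M ─ A)
    ... | no W─A=∅  | _ rewrite eM-empty A W─A=∅ = z≤n
    ... | yes _     | no M─A=∅ rewrite empty⇒∣p∣≡0 M─A=∅ =
      ⊴-zero-denominator (slope W A) (eM G (M ─ A) A)
    ... | yes W─A≠∅ | yes M─A≠∅ =
      ≤⇒⊴ (nonempty⇒∣p∣>0 W─A≠∅) (nonempty⇒∣p∣>0 M─A≠∅) (densest-≤ A⊆W)

    -- If M = A then outerDensity M A is the junk value 0, so any C ⊋ A is at least as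
    -- dense as M and strictly larger.
    densest-nonempty : ∀ {C} → A ⊂ C → Nonempty (M ─ A)
    densest-nonempty {C} A⊂C with nonempty? (M ─ A)
    ... | yes M─A≠∅ = M─A≠∅
    ... | no  M─A=∅ = contradiction (densest-size (proj₁ A⊂C) M-sparsest)
      (ℕ.<⇒≱ (subst (ℕ._< ∣ C ─ A ∣) (sym (empty⇒∣p∣≡0 M─A=∅))
                    (nonempty⇒∣p∣>0 (⊂⇒nonempty-─ A⊂C))))
      where
      M-sparsest : outerDensity G M A ℚ.≤ outerDensity G C A
      M-sparsest = subst (ℚ._≤ outerDensity G C A) (sym (cong (ratio G _) (empty⇒∣p∣≡0 M─A=∅)))
                         (value-nonneg (slope C A))

    densest-⋬-extension : Nonempty (M ─ A) → ∀ {W} → M ⊆ W → Nonempty (W ─ M) →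
      ¬ (slope M A ⊴ slope W M)
    densest-⋬-extension M─A≠∅ {W} M⊆W W─M≠∅ ρ⊴slope =
      ℕ.<⇒≱ (ℕ.m<m+n ∣ M ─ A ∣ (nonempty⇒∣p∣>0 W─M≠∅))
            (subst (ℕ._≤ ∣ M ─ A ∣) ∣W─A∣
              (densest-size A⊆W (⊴⇒≤ (nonempty⇒∣p∣>0 M─A≠∅) W─A>0 ρ⊴W)))
      where
      A⊆W : A ⊆ W
      A⊆W = ⊆-trans (proj₁ M-densest) M⊆W
      tower : slope W A ≡ slope M A ⊞ slope W M
      tower = slope-tower (proj₁ M-densest) M⊆W
      ∣W─A∣ : ∣ W ─ A ∣ ≡ ∣ M ─ A ∣ + ∣ W ─ M ∣
      ∣W─A∣ = cong proj₂ tower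
      W─A>0 : 0 ℕ.< ∣ W ─ A ∣
      W─A>0 = subst (0 ℕ.<_) (sym ∣W─A∣) (ℕ.<-≤-trans (nonempty⇒∣p∣>0 W─M≠∅) (ℕ.m≤n+m _ _))
      ρ⊴W : slope M A ⊴ slope W A
      ρ⊴W = subst (slope M A ⊴_) (sym tower)
        (⊴-⊞ (slope M A) (slope M A) (slope W M) (⊴-refl (slope M A)) ρ⊴slope)

    densest-⊴-removed : LocallyDense G A → Nonempty (M ─ A) → ∀ {X} → X ⊆ M →
      slope M A ⊴ slope M (M ─ X)
    densest-⊴-removed A-dense M─A≠∅ {X} X⊆M =
      subst (ρ ⊴_) (sym (slope-tower B⊆B' B'⊆M)) (⊴-⊞ ρ (slope B' B) (slope M B') ρ⊴inner ρ⊴outer)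
      where
      -- X is split into M ∖ B' = X ∖ A, paid for by the maximality of M, and
      -- B' ∖ B = X ∩ A, paid for by the local density of A.
      ρ : Frac
      ρ = slope M A
      A⊆M : A ⊆ M
      A⊆M = proj₁ M-densest
      B B' : Subset n
      B  = M ─ X
      B' = B ∪ A
      B⊆B' : B ⊆ B'
      B⊆B' = p⊆p∪q A
      A⊆B' : A ⊆ B'
      A⊆B' = q⊆p∪q B A
      B'⊆M : B' ⊆ M
      B'⊆M x∈B' = [ p─q⊆p M X , A⊆M ]′ (x∈p∪q⁻ B A x∈B')
      ρ⊴outer : ρ ⊴ slope M B'
      ρ⊴outer = ⊴-⊞-cancel ρ (slope M B') (slope B' A)
        (subst (ρ ⊴_) (slope-tower A⊆B' B'⊆M) (⊴-refl ρ)) (densest-⊴ A⊆B')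
      ρ⊴A─B : ρ ⊴ slope A B
      ρ⊴A─B with nonempty? (A ─ B)
      ... | no A─B=∅ rewrite empty⇒∣p∣≡0 A─B=∅ = ⊴-zero-denominator ρ (eM G (A ─ B) B)
      ... | yes A─B≠∅ = ⊴-mono-numerator ρ ∣ A ─ B ∣ (eM-monoʳ (A ─ B) (p─[p─q]⊆q A B))
        (≤⇒⊴ (nonempty⇒∣p∣>0 M─A≠∅) (nonempty⇒∣p∣>0 A─B≠∅)
          (ℚ.<⇒≤ (subst₂ ℚ._<_ (outerDensity-─ M A)
            (cong (λ Z → ratio G (eM G Z (A ─ (A ─ B))) ∣ Z ∣) (p─[q─p]≡p (A ─ B) A))
            (locallyDense⇒< A-dense (p─q⊆p A B) A─B≠∅ M─A≠∅ ([p─q]∩q-empty M A)))))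
      ρ⊴inner : ρ ⊴ slope B' B
      ρ⊴inner = subst (ρ ⊴_) (cong (λ Z → eM G Z B , ∣ Z ∣) (sym ([p∪q]─p≡q─p B A))) ρ⊴A─B

    densest-locallyDense : LocallyDense G A → Nonempty (M ─ A) → LocallyDense G M
    densest-locallyDense A-dense M─A≠∅ (X , Y , X⊆M , X≠∅ , Y≠∅ , Y∩M=∅ , X-sparse) =
      ℚ.<-irrefl refl (ℚ.≤-<-trans (ℚ.≤-trans ρ≤X X-sparse) Y<ρ)
      where
      ρ≤X : outerDensity G M A ℚ.≤ outerDensity G X (M ─ X)
      ρ≤X = subst (outerDensity G M A ℚ.≤_)
        (outerDensity-cong (trans (p─[p─q]≡q X⊆M) (sym (p─[q─p]≡p X M))))
        (⊴⇒≤ (nonempty⇒∣p∣>0 M─A≠∅)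
             (subst (λ Z → 0 ℕ.< ∣ Z ∣) (sym (p─[p─q]≡q X⊆M)) (nonempty⇒∣p∣>0 X≠∅))
             (densest-⊴-removed A-dense M─A≠∅ X⊆M))
      M∪Y─M≠∅ : Nonempty ((M ∪ Y) ─ M)
      M∪Y─M≠∅ = let y , y∈Y = Y≠∅ in
        y , x∈p∧x∉q⇒x∈p─q (q⊆p∪q M Y y∈Y) λ y∈M → Y∩M=∅ (y , x∈p∩q⁺ (y∈Y , y∈M))
      Y<ρ : outerDensity G Y M ℚ.< outerDensity G M A
      Y<ρ = subst (ℚ._< outerDensity G M A) (outerDensity-cong ([p∪q]─p≡q─p M Y)) (ℚ.≰⇒> λ ρ≤ →
        densest-⋬-extension M─A≠∅ (p⊆p∪q Y) M∪Y─M≠∅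
          (≤⇒⊴ (nonempty⇒∣p∣>0 M─A≠∅) (nonempty⇒∣p∣>0 M∪Y─M≠∅) ρ≤))

    densest-⊴-union : ∀ {W} → A ⊆ W → slope M A ⊴ slope W A → slope M A ⊴ slope (M ∪ W) M
    densest-⊴-union {W} A⊆W ρ⊴W =
      subst (ρ ⊴_) (cong (λ Z → eM G Z M , ∣ Z ∣) (sym ([p∪q]─p≡q─p M W)))
        (⊴-mono-numerator ρ ∣ W ─ M ∣ (eM-monoʳ (W ─ M) I⊆M)
          (subst (ρ ⊴_) (cong (λ Z → eM G Z I , ∣ Z ∣) (p─[p─q]≡q (p─q⊆p W M))) ρ⊴W─I))
      where
      ρ : Frac
      ρ = slope M A
      I : Subset n
      I = W ─ (W ─ M)
      A⊆I : A ⊆ I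
      A⊆I x∈A = x∈p∧x∉q⇒x∈p─q (A⊆W x∈A) λ x∈W─M → x∈p─q⇒x∉q W M x∈W─M (proj₁ M-densest x∈A)
      I⊆M : I ⊆ M
      I⊆M = p─[p─q]⊆q W M
      ρ⊴W─I : ρ ⊴ slope W I
      ρ⊴W─I = ⊴-⊞-cancel ρ (slope W I) (slope I A)
        (subst (ρ ⊴_) (slope-tower A⊆I (p─q⊆p W (W ─ M))) ρ⊴W) (densest-⊴ A⊆I)

  locallyDense-superset-< : ∀ {A C U} → LocallyDense G C → A ⊆ C → Nonempty (C ─ A) →
    C ⊆ U → Nonempty (U ─ C) → outerDensity G U A ℚ.< outerDensity G C A
  locallyDense-superset-< {A} {C} {U} C-dense A⊆C C─A≠∅ C⊆U U─C≠∅ = ℚ.≰⇒> λ C≤U →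
    ℚ.<-irrefl refl (ℚ.<-≤-trans U-marginal<C (⊴⇒≤ C─A>0 (nonempty⇒∣p∣>0 U─C≠∅)
      (⊴-⊞-cancel (slope C A) (slope U C) (slope C A)
        (subst (slope C A ⊴_) tower (≤⇒⊴ C─A>0 U─A>0 C≤U)) (⊴-refl (slope C A)))))
    where
    tower : slope U A ≡ slope C A ⊞ slope U C
    tower = slope-tower A⊆C C⊆U
    C─A>0 : 0 ℕ.< ∣ C ─ A ∣
    C─A>0 = nonempty⇒∣p∣>0 C─A≠∅
    U─A>0 : 0 ℕ.< ∣ U ─ A ∣
    U─A>0 = subst (0 ℕ.<_) (sym (cong proj₂ tower)) (ℕ.<-≤-trans C─A>0 (ℕ.m≤m+n _ _))
    U-marginal<C : outerDensity G U C ℚ.< outerDensity G C A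
    U-marginal<C = subst₂ ℚ._<_ (outerDensity-─ U C)
      (trans (cong (outerDensity G (C ─ A)) (p─[p─q]≡q A⊆C)) (outerDensity-─ C A))
      (locallyDense⇒< C-dense (p─q⊆p C A) C─A≠∅ U─C≠∅ ([p─q]∩q-empty U C))

  densest-is-successor : ∀ {A C M} → LocallyDense G A → LocallyDense G C → A ⊂ C →
    (∀ L → LocallyDense G L → A ⊂ L → C ⊆ L) → DensestAbove A M → M ≡ C
  densest-is-successor {A} {C} {M} A-dense C-dense A⊂C next M-densest = ⊆-antisym M⊆C C⊆M
    where
    M─A≠∅ : Nonempty (M ─ A)
    M─A≠∅ = densest-nonempty M-densest A⊂C
    C⊆M : C ⊆ M
    C⊆M = next M (densest-locallyDense M-densest A-dense M─A≠∅)
                 (nonempty-─⇒⊂ (proj₁ M-densest) M─A≠∅)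
    M⊆C : M ⊆ C
    M⊆C {x} x∈M with x ∈? C
    ... | yes x∈C = x∈C
    ... | no  x∉C = contradiction
      (ℚ.<-≤-trans (locallyDense-superset-< C-dense (proj₁ A⊂C) (⊂⇒nonempty-─ A⊂C) C⊆M
                                            (x , x∈p∧x∉q⇒x∈p─q x∈M x∉C))
                   (densest-≤ M-densest (proj₁ A⊂C)))
      (ℚ.<-irrefl refl)

  successor-densest : ∀ {A C} → LocallyDense G A → LocallyDense G C → A ⊂ C →
    (∀ L → LocallyDense G L → A ⊂ L → C ⊆ L) →
    (∀ W → A ⊂ W → outerDensity G W A ℚ.≤ outerDensity G C A) ×
    (∀ W → A ⊂ W → outerDensity G W A ≡ outerDensity G C A → W ⊆ C)
  successor-densest {A} {C} A-dense C-dense A⊂C next =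
    (λ W A⊂W → densest-≤ C-densest (proj₁ A⊂W)) , C-unique
    where
    C-densest : DensestAbove A C
    C-densest with densestAbove-exists A
    ... | M , M-densest =
      subst (DensestAbove A) (densest-is-successor A-dense C-dense A⊂C next M-densest) M-densest
    C-unique : ∀ W → A ⊂ W → outerDensity G W A ≡ outerDensity G C A → W ⊆ C
    C-unique W A⊂W W≈C {x} x∈W with x ∈? C
    ... | yes x∈C = x∈C
    ... | no  x∉C = ⊥-elim (densest-⋬-extension C-densest (⊂⇒nonempty-─ A⊂C) (p⊆p∪q W)
      (x , x∈p∧x∉q⇒x∈p─q (q⊆p∪q C W x∈W) x∉C)
      (densest-⊴-union C-densest (proj₁ A⊂W)
        (≤⇒⊴ (nonempty⇒∣p∣>0 (⊂⇒nonempty-─ A⊂C)) (nonempty⇒∣p∣>0 (⊂⇒nonempty-─ A⊂W))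
             (ℚ.≤-reflexive (sym W≈C)))))

module LocallyDenseChain {n k : ℕ} (G : Graph n) (B : Fin (suc k) → Subset n)
  (chain : ∀ (i : Fin k) → B (inject₁ i) ⊂ B (suc i))
  (all-dense : ∀ (W : Subset n) → LocallyDense G W ⇔ Σ (Fin (suc k)) (λ i → W ≡ B i)) where

  open Densities G

  chain-mono : ∀ {i j} → i Fin.≤ j → B i ⊆ B j
  chain-mono {i} = <-weakInduction-startingFrom (λ j → B i ⊆ B j) ⊆-refl
    λ j Bi⊆Bj → ⊆-trans Bi⊆Bj (proj₁ (chain j))

  B-dense : ∀ i → LocallyDense G (B i)
  B-dense i = Equivalence.from (all-dense (B i)) (i , refl)

  dense-index : ∀ {W} → LocallyDense G W → Σ (Fin (suc k)) (λ i → W ≡ B i)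
  dense-index {W} = Equivalence.to (all-dense W)

  first≡⊥ : B zero ≡ ⊥
  first≡⊥ with dense-index ⊥-locallyDense
  ... | j , ⊥≡Bj = ⊆-antisym (subst (B zero ⊆_) (sym ⊥≡Bj) (chain-mono z≤n)) ⊥⊆

  last≡⊤ : B (fromℕ k) ≡ ⊤
  last≡⊤ with dense-index ⊤-locallyDense
  ... | j , ⊤≡Bj = ⊆-antisym ⊆⊤ (subst (_⊆ B (fromℕ k)) (sym ⊤≡Bj) (chain-mono (≤fromℕ j)))

  successor-⊆-dense-superset : ∀ i L → LocallyDense G L → B (inject₁ i) ⊂ L → B (suc i) ⊆ L
  successor-⊆-dense-superset i L L-dense (_ , x , x∈L , x∉Bi) with dense-index L-dense
  ... | j , L≡Bj with j Fin.≤? inject₁ i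
  ...   | yes j≤i = contradiction (chain-mono j≤i (subst (x ∈_) L≡Bj x∈L)) x∉Bi
  ...   | no  j≰i = subst (B (suc i) ⊆_) (sym L≡Bj)
    (chain-mono (subst (ℕ._< toℕ j) (toℕ-inject₁ i) (ℕ.≰⇒> j≰i)))

proposition2 : {n : ℕ} (G : Graph n) (k : ℕ) (B : Fin (suc k) → Subset n) →
    (∀ (i : Fin k) → B (inject₁ i) ⊂ B (suc i)) →
    (∀ (W : Subset n) → LocallyDense G W ⇔ Σ (Fin (suc k)) (λ i → W ≡ B i)) →
    (B zero ≡ ⊥) × (B (fromℕ k) ≡ ⊤) ×
    (∀ (i : Fin k) →
      (∀ (W : Subset n) → B (inject₁ i) ⊂ W →
        outerDensity G W (B (inject₁ i)) ≤ outerDensity G (B (suc i)) (B (inject₁ i))) ×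
      (∀ (W : Subset n) → B (inject₁ i) ⊂ W →
        outerDensity G W (B (inject₁ i)) ≡ outerDensity G (B (suc i)) (B (inject₁ i)) →
        W ⊆ B (suc i)))
proposition2 G k B chain all-dense = first≡⊥ , last≡⊤ , λ i →
  successor-densest (B-dense (inject₁ i)) (B-dense (suc i)) (chain i) (successor-⊆-dense-superset i)
  where
  open Densities G
  open LocallyDenseChain G B chain all-dense
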